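{- Let $\mathbb{K}=(G,M,I)$ be a context and $\mathbb{KC}_{SD}=((G,E_1),(M,E_2),I)$ the associated Kripke context. For every semiconcept $(A,B)$ of $\mathbb{K}$, $\underline{(A,B)}\sqsubseteq(A,B)$ and $(A,B)\sqsubseteq\overline{(A,B)}$.
   Context: A context is $\mathbb{K}=(G,M,I)$ with $I\subseteq G\times M$. For $A\subseteq G$, $A'=\{m\in M:gIm\ \forall g\in A\}$; for $B\subseteq M$, $B'=\{g\in G:gIm\ \forall m\in B\}$. A semiconcept is a pair $(A,B)$ with $A'=B$ or $B'=A$; a concept is a pair with $A'=B$ and $B'=A$; $\mathfrak{H}(\mathbb{K})$ and $\mathcal{B}(\mathbb{K})$ denote the sets of semiconcepts and concepts. On $\mathfrak{H}(\mathbb{K})$: $(A_1,B_1)\sqcap(A_2,B_2)=(A_1\cap A_2,(A_1\cap A_2)')$, $(A_1,B_1)\sqcup(A_2,B_2)=((B_1\cap B_2)',B_1\cap B_2)$, and $x\sqsubseteq y$ iff $x\sqcap y=x\sqcap x$ and $x\sqcup y=y\sqcup y$. Left semiconcepts are those of the form $(A,A')$ (set $\mathfrak{H}(\mathbb{K})_\sqcap$), right semiconcepts those of the form $(B',B)$ (set $\mathfrak{H}(\mathbb{K})_\sqcup$). Define equivalence relations $E_1$ on $G$ by $g_1E_1g_2$ iff $I(g_1)=I(g_2)$, where $I(g)=\{m:gIm\}$, and $E_2$ on $M$ by $m_1E_2m_2$ iff $I^{ -1}(m_1)=I^{ -1}(m_2)$, where $I^{ -1}(m)=\{g:gIm\}$;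 $\mathbb{KC}_{SD}:=((G,E_1),(M,E_2),I)$. For a relation $E$ on $W$ and $X\subseteq W$, with $E(x)=\{y:xEy\}$: $\underline{X}_E=\{x:E(x)\subseteq X\}$ and $\overline{X}^E=\{x:E(x)\cap X\neq\emptyset\}$. Approximations of a semiconcept $(A,B)$: if $(A,B)\in\mathcal{B}(\mathbb{K})$, then $\underline{(A,B)}=\overline{(A,B)}=(A,B)$; if $(A,B)\in\mathfrak{H}(\mathbb{K})_\sqcap\setminus\mathcal{B}(\mathbb{K})$, then $\underline{(A,B)}=(\underline{A}_{E_1},(\underline{A}_{E_1})')$ and $\overline{(A,B)}=(\overline{A}^{E_1},(\overline{A}^{E_1})')$; if $(A,B)\in\mathfrak{H}(\mathbb{K})_\sqcup\setminus\mathcal{B}(\mathbb{K})$, then $\underline{(A,B)}=((\overline{B}^{E_2})',\overline{B}^{E_2})$ and $\overline{(A,B)}=((\underline{B}_{E_2})',\underline{B}_{E_2})$. -}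

module Defs where

open import Level using (0ℓ)
open import Data.Product using (Σ; _×_; _,_; ∃)
open import Data.Sum using (_⊎_)
open import Relation.Nullary using (¬_)
open import Relation.Unary using (Pred; _≐_; _∩_)
open import Function.Bundles using (_⇔_)

record Context : Set₁ where
  field
    G : Set
    M : Set
    I : G → M → Set

module _ (K : Context) where
  open Context K

  _′ᴳ : Pred G 0ℓ → Pred M 0ℓ
  (A ′ᴳ) m = ∀ g → A g → I g m

  _′ᴹ : Pred M 0ℓ → Pred G 0ℓ
  (B ′ᴹ) g = ∀ m → B m → I g m

  Pair : Set₁
  Pair = Pred G 0ℓ × Pred M 0ℓ

  _≈_ : Pair → Pair → Set
  (A₁ , B₁) ≈ (A₂ , B₂) = (A₁ ≐ A₂) × (B₁ ≐ B₂)

  IsSemiconcept : Pair → Set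
  IsSemiconcept (A , B) = ((A ′ᴳ) ≐ B) ⊎ ((B ′ᴹ) ≐ A)

  IsConcept : Pair → Set
  IsConcept (A , B) = ((A ′ᴳ) ≐ B) × ((B ′ᴹ) ≐ A)

  IsLeft : Pair → Set
  IsLeft (A , B) = B ≐ (A ′ᴳ)

  IsRight : Pair → Set
  IsRight (A , B) = A ≐ (B ′ᴹ)

  _⊓_ : Pair → Pair → Pair
  (A₁ , B₁) ⊓ (A₂ , B₂) = (A₁ ∩ A₂) , ((A₁ ∩ A₂) ′ᴳ)

  _⊔_ : Pair → Pair → Pair
  (A₁ , B₁) ⊔ (A₂ , B₂) = ((B₁ ∩ B₂) ′ᴹ) , (B₁ ∩ B₂)

  _⊑_ : Pair → Pair → Set
  x ⊑ y = ((x ⊓ y) ≈ (x ⊓ x)) × ((x ⊔ y) ≈ (y ⊔ y))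

  E₁ : G → G → Set
  E₁ g₁ g₂ = ∀ m → I g₁ m ⇔ I g₂ m

  E₂ : M → M → Set
  E₂ m₁ m₂ = ∀ g → I g m₁ ⇔ I g m₂

module _ {W : Set} (E : W → W → Set) where
  lowerSet : Pred W 0ℓ → Pred W 0ℓ
  lowerSet X x = ∀ y → E x y → X y

  upperSet : Pred W 0ℓ → Pred W 0ℓ
  upperSet X x = ∃ λ y → E x y × X y

module _ (K : Context) where
  open Context K

  -- "y is (a representative of) the lower approximation of the semiconcept x",
  -- following the three-case definition.
  IsLowerApprox : Pair K → Pair K → Set
  IsLowerApprox (A , B) y =
      (IsConcept K (A , B) × _≈_ K y (A , B))
    ⊎ (IsLeft K (A , B) × ¬ IsConcept K (A , B) ×
         _≈_ K y (lowerSet (E₁ K) A , _′ᴳ K (lowerSet (E₁ K) A)))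
    ⊎ (IsRight K (A , B) × ¬ IsConcept K (A , B) ×
         _≈_ K y (_′ᴹ K (upperSet (E₂ K) B) , upperSet (E₂ K) B))

  IsUpperApprox : Pair K → Pair K → Set
  IsUpperApprox (A , B) y =
      (IsConcept K (A , B) × _≈_ K y (A , B))
    ⊎ (IsLeft K (A , B) × ¬ IsConcept K (A , B) ×
         _≈_ K y (upperSet (E₁ K) A , _′ᴳ K (upperSet (E₁ K) A)))
    ⊎ (IsRight K (A , B) × ¬ IsConcept K (A , B) ×
         _≈_ K y (_′ᴹ K (lowerSet (E₂ K) B) , lowerSet (E₂ K) B))

{-# OPTIONS --safe #-}
-- Both approximations are computed from reflexive relations, so the lower
-- approximation of a set shrinks it and the upper one enlarges it. Together with
-- the antitonicity of the derivation operators this gives inclusions in both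
-- components, which is exactly what ⊑ amounts to.
module Submission where

open import Level using (0ℓ)
open import Defs
open import Data.Product using (_×_; _,_)
open import Data.Sum using (inj₁; inj₂)
open import Relation.Unary using (Pred; _⊆_)
open import Relation.Binary using (Reflexive)
open import Function.Construct.Identity using (⇔-id)

module _ {W : Set} (E : W → W → Set) (E-refl : Reflexive E) where

  lowerSet-⊆ : (X : Pred W 0ℓ) → lowerSet E X ⊆ X
  lowerSet-⊆ X x∈lower = x∈lower _ E-refl

  ⊆-upperSet : (X : Pred W 0ℓ) → X ⊆ upperSet E X
  ⊆-upperSet X x∈X = _ , E-refl , x∈X

module _ (K : Context) where
  open Context K

  E₁-refl : Reflexive (E₁ K)
  E₁-refl m = ⇔-id _

  E₂-refl : Reflexive (E₂ K)
  E₂-refl g = ⇔-id _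

  ′ᴳ-antitone : {X Y : Pred G 0ℓ} → X ⊆ Y → _′ᴳ K Y ⊆ _′ᴳ K X
  ′ᴳ-antitone X⊆Y m∈Y′ g g∈X = m∈Y′ g (X⊆Y g∈X)

  ′ᴹ-antitone : {X Y : Pred M 0ℓ} → X ⊆ Y → _′ᴹ K Y ⊆ _′ᴹ K X
  ′ᴹ-antitone X⊆Y g∈Y′ m m∈X = g∈Y′ m (X⊆Y m∈X)

  infix 4 _≼_

  _≼_ : Pair K → Pair K → Set
  (A₁ , B₁) ≼ (A₂ , B₂) = (A₁ ⊆ A₂) × (B₂ ⊆ B₁)

  ≼-trans : {x y z : Pair K} → x ≼ y → y ≼ z → x ≼ z
  ≼-trans (A₁⊆A₂ , B₂⊆B₁) (A₂⊆A₃ , B₃⊆B₂) =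
    (λ a → A₂⊆A₃ (A₁⊆A₂ a)) , (λ b → B₂⊆B₁ (B₃⊆B₂ b))

  ≈⇒≼ : {x y : Pair K} → _≈_ K x y → x ≼ y
  ≈⇒≼ ((A₁⊆A₂ , _) , (_ , B₂⊆B₁)) = A₁⊆A₂ , B₂⊆B₁

  ≈⇒≽ : {x y : Pair K} → _≈_ K x y → y ≼ x
  ≈⇒≽ ((_ , A₂⊆A₁) , (B₁⊆B₂ , _)) = A₂⊆A₁ , B₁⊆B₂

  ≼⇒⊑ : {x y : Pair K} → x ≼ y → _⊑_ K x y
  ≼⇒⊑ (A₁⊆A₂ , B₂⊆B₁) =
    ( ( (λ (a , _) → a , a) , (λ (a , _) → a , A₁⊆A₂ a) )
    , ( (λ m∈′ g (a , _) → m∈′ g (a , A₁⊆A₂ a)) , (λ m∈′ g (a , _) → m∈′ g (a , a)) ) )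
    , ( ( (λ g∈′ m (_ , b) → g∈′ m (B₂⊆B₁ b , b)) , (λ g∈′ m (_ , b) → g∈′ m (b , b)) )
      , ( (λ (_ , b) → b , b) , (λ (_ , b) → B₂⊆B₁ b , b) ) )

  module _ {A : Pred G 0ℓ} {B : Pred M 0ℓ} where

    lowerLeft-≼ : IsLeft K (A , B) →
      (lowerSet (E₁ K) A , _′ᴳ K (lowerSet (E₁ K) A)) ≼ (A , B)
    lowerLeft-≼ (B⊆A′ , _) = lower⊆A , λ b → ′ᴳ-antitone lower⊆A (B⊆A′ b)
      where
      lower⊆A : lowerSet (E₁ K) A ⊆ A
      lower⊆A = lowerSet-⊆ (E₁ K) E₁-refl A

    lowerRight-≼ : IsRight K (A , B) →
      (_′ᴹ K (upperSet (E₂ K) B) , upperSet (E₂ K) B) ≼ (A , B)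
    lowerRight-≼ (_ , B′⊆A) = (λ g → B′⊆A (′ᴹ-antitone B⊆upper g)) , B⊆upper
      where
      B⊆upper : B ⊆ upperSet (E₂ K) B
      B⊆upper = ⊆-upperSet (E₂ K) E₂-refl B

    upperLeft-≽ : IsLeft K (A , B) →
      (A , B) ≼ (upperSet (E₁ K) A , _′ᴳ K (upperSet (E₁ K) A))
    upperLeft-≽ (_ , A′⊆B) = A⊆upper , λ m → A′⊆B (′ᴳ-antitone A⊆upper m)
      where
      A⊆upper : A ⊆ upperSet (E₁ K) A
      A⊆upper = ⊆-upperSet (E₁ K) E₁-refl A

    upperRight-≽ : IsRight K (A , B) →
      (A , B) ≼ (_′ᴹ K (lowerSet (E₂ K) B) , lowerSet (E₂ K) B)
    upperRight-≽ (A⊆B′ , _) = (λ a → ′ᴹ-antitone lower⊆B (A⊆B′ a)) , lower⊆B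
      where
      lower⊆B : lowerSet (E₂ K) B ⊆ B
      lower⊆B = lowerSet-⊆ (E₂ K) E₂-refl B

  lowerApprox-≼ : (x y : Pair K) → IsLowerApprox K x y → y ≼ x
  lowerApprox-≼ x y (inj₁ (_ , y≈x))                = ≈⇒≼ y≈x
  lowerApprox-≼ x y (inj₂ (inj₁ (left , _ , y≈l)))  = ≼-trans (≈⇒≼ y≈l) (lowerLeft-≼ left)
  lowerApprox-≼ x y (inj₂ (inj₂ (right , _ , y≈l))) = ≼-trans (≈⇒≼ y≈l) (lowerRight-≼ right)

  upperApprox-≽ : (x y : Pair K) → IsUpperApprox K x y → x ≼ y
  upperApprox-≽ x y (inj₁ (_ , y≈x))                = ≈⇒≽ y≈x
  upperApprox-≽ x y (inj₂ (inj₁ (left , _ , y≈u)))  = ≼-trans (upperLeft-≽ left) (≈⇒≽ y≈u)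
  upperApprox-≽ x y (inj₂ (inj₂ (right , _ , y≈u))) = ≼-trans (upperRight-≽ right) (≈⇒≽ y≈u)

proposition104 : (K : Context) (x : Pair K) → IsSemiconcept K x →
    (∀ y → IsLowerApprox K x y → _⊑_ K y x) ×
    (∀ y → IsUpperApprox K x y → _⊑_ K x y)
-- The semiconcept hypothesis is not needed: each case of the approximation
-- predicates carries its own left/right/concept hypothesis.
proposition104 K x _ =
  (λ y y-lower → ≼⇒⊑ K (lowerApprox-≼ K x y y-lower)) ,
  (λ y y-upper → ≼⇒⊑ K (upperApprox-≽ K x y y-upper))
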